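{- For every $n\ge 4$, every element $(a,b)$ of $A_n$ is column-0 unfit in $Q_{n+1}$, i.e. there is no index $j\in\{0,\ldots,n\}$ with $m_j(I_{a+b})=\min\{a,b\}$, where $I_{a+b}\subseteq Q_{n+1}$.
   Context: $Q_N=\{0,1\}^N$ is the set of binary strings $x_0\ldots x_{N-1}$, identified with integers $\sum_i x_i2^{N-1-i}$; for $0\le k\le 2^N$, $I_k\subseteq Q_N$ is the set of strings with value $<k$. For $S\subseteq Q_N$, $m_j(S)$ is the number of $x\in S$ with $x_j=1$. For $n\ge 2$ let $S'_n=\{(a,b)\in\mathbb{Z}^2: 2^n-2^{n-2}<a,b<2^n,\ |a-b|\ge 2\}$. Define sets $A_n\subseteq\mathbb{Z}^2$ for $n\ge 4$ by $A_4=\{(13,15),(15,13)\}$ and, for $n\ge 4$, $A_{n+1}$ is the union of (1) the sets $\{2a_0-1,2a_0,2a_0+1\}\times\{2b_0-1,2b_0,2b_0+1\}$ over all $(a_0,b_0)\in A_n$, and (2) all pairs $(a,a-2)$ and $(a-2,a)$ lying in $S'_{n+1}$ with $a\equiv 3\pmod 4$. -}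

module Defs where

open import Data.Nat using (ℕ; zero; suc; _+_; _*_; _∸_; _^_; _<_; _≤_; _≥_; _<?_; ∣_-_∣; _%_)
open import Data.Bool using (Bool; true; false; _≟_)
open import Data.Fin using (Fin; toℕ)
open import Data.Vec using (Vec; []; _∷_; lookup)
open import Data.List using (List; []; _∷_; map; _++_; filter; length)
open import Data.Product using (_×_; _,_)
open import Relation.Binary.PropositionalEquality using (_≡_)

Q : (N : ℕ) → List (Vec Bool N)
Q zero    = [] ∷ []
Q (suc N) = map (false ∷_) (Q N) ++ map (true ∷_) (Q N)

bitVal : Bool → ℕ
bitVal false = 0
bitVal true  = 1

value : {N : ℕ} → Vec Bool N → ℕ
value {zero}  []      = 0
value {suc N} (b ∷ x) = bitVal b * 2 ^ N + value x

I : (N k : ℕ) → List (Vec Bool N)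
I N k = filter (λ x → value x <? k) (Q N)

m : {N : ℕ} → Fin N → List (Vec Bool N) → ℕ
m j S = length (filter (λ x → lookup x j ≟ true) S)

S′ : ℕ → ℕ × ℕ → Set
S′ n (a , b) =
  (2 ^ n ∸ 2 ^ (n ∸ 2) < a) × (a < 2 ^ n) ×
  (2 ^ n ∸ 2 ^ (n ∸ 2) < b) × (b < 2 ^ n) × (∣ a - b ∣ ≥ 2)

-- A_n as an inductive family (nonempty only for n ≥ 4).
-- All elements are positive, so we work in ℕ.  The lift step
-- a ∈ {2a₀-1, 2a₀, 2a₀+1} is written as a + 1 = 2a₀ + da with da ∈ {0,1,2}.
data A : ℕ → ℕ × ℕ → Set where
  base₁ : A 4 (13 , 15)
  base₂ : A 4 (15 , 13)
  lift  : ∀ {n a₀ b₀} → A n (a₀ , b₀) → (da db : Fin 3) → ∀ {a b} →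
          a + 1 ≡ 2 * a₀ + toℕ da → b + 1 ≡ 2 * b₀ + toℕ db →
          A (suc n) (a , b)
  new₁  : ∀ {n a} → 4 ≤ n → a % 4 ≡ 3 → S′ (suc n) (a , a ∸ 2) → A (suc n) (a , a ∸ 2)
  new₂  : ∀ {n a} → 4 ≤ n → a % 4 ≡ 3 → S′ (suc n) (a ∸ 2 , a) → A (suc n) (a ∸ 2 , a)

{-# OPTIONS --safe #-}
module Submission where

-- Write d_l(k) for the distance from k to the nearest multiple of 2^l. For k ≤ 2^N, counting the
-- strings of I_k with x_j = 1 gives 2 m_j(I_k) + d_{N-j}(k) = k; since also 2 min(a,b) + |a-b| = a+b,
-- column j is fit for (a,b) exactly when d_{N-j}(a+b) = |a-b|. By induction on A_n we show the
-- stronger ||a-b| - d_l(a+b)| ≥ 2 for every l. A new pair has |a-b| = 2 and a+b = 4·odd, so d_l(a+b)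
-- is 0 (l ≤ 2) or at least 4. For a lifted pair, |a-b| is within |da-db| of 2|a₀-b₀|, and since
-- d_{l+1}(2k) = 2 d_l(k) and d_{l+1} is 1-Lipschitz, d_{l+1}(a+b) is within |da+db-2| of
-- 2 d_l(a₀+b₀); the two errors add up to at most 2, while doubling turned the gap 2 into 4.

open import Defs
open import Data.Nat
open import Data.Nat.Properties
open import Data.Nat.DivMod
open import Data.Nat.Divisibility
open import Data.Nat.Tactic.RingSolver using (solve-∀)
open import Data.Bool using (Bool; true; false)
open import Data.Fin using (Fin; zero; suc; toℕ)
open import Data.Fin.Properties using (toℕ≤pred[n])
open import Data.Vec using (Vec; _∷_)
open import Data.List using (List; []; _∷_; map; _++_; filter; length)
open import Data.List.Properties using (filter-++; filter-≐; length-++; length-map)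
open import Data.Product using (_×_; _,_; ∃-syntax)
open import Data.Sum using (_⊎_; inj₁; inj₂; [_,_]′)
open import Function using (_∘_)
open import Relation.Binary.PropositionalEquality
open import Relation.Nullary using (Dec; yes; no; does; contradiction)
open import Relation.Nullary.Decidable using (toWitness)
open import Relation.Unary using (Pred; Decidable)

m≤o+n⇒n≤o+m⇒∣m-n∣≤o : ∀ {m n o} → m ≤ o + n → n ≤ o + m → ∣ m - n ∣ ≤ o
m≤o+n⇒n≤o+m⇒∣m-n∣≤o {m} {n} m≤o+n n≤o+m with ∣m-n∣≡[m∸n]∨[n∸m] m n
... | inj₁ eq = subst (_≤ _) (sym eq) (m≤n+o⇒m∸n≤o m n (subst (m ≤_) (+-comm _ n) m≤o+n))
... | inj₂ eq = subst (_≤ _) (sym eq) (m≤n+o⇒m∸n≤o n m (subst (n ≤_) (+-comm _ m) n≤o+m))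

∣m+o-n+o∣≡∣m-n∣ : ∀ m n o → ∣ m + o - n + o ∣ ≡ ∣ m - n ∣
∣m+o-n+o∣≡∣m-n∣ m n o = trans (cong₂ ∣_-_∣ (+-comm m o) (+-comm n o)) (∣m+n-m+o∣≡∣n-o∣ o m n)

∣∣m+o-n+p∣-∣m-n∣∣≤∣o-p∣ : ∀ m n o p → ∣ ∣ m + o - n + p ∣ - ∣ m - n ∣ ∣ ≤ ∣ o - p ∣
∣∣m+o-n+p∣-∣m-n∣∣≤∣o-p∣ m n o p = m≤o+n⇒n≤o+m⇒∣m-n∣≤o
  (begin
    ∣ m + o - n + p ∣                      ≤⟨ ∣-∣-triangle (m + o) (n + o) (n + p) ⟩
    ∣ m + o - n + o ∣ + ∣ n + o - n + p ∣  ≡⟨ cong₂ _+_ (∣m+o-n+o∣≡∣m-n∣ m n o) (∣m+n-m+o∣≡∣n-o∣ n o p) ⟩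
    ∣ m - n ∣ + ∣ o - p ∣                  ≡⟨ +-comm ∣ m - n ∣ ∣ o - p ∣ ⟩
    ∣ o - p ∣ + ∣ m - n ∣                  ∎)
  (begin
    ∣ m - n ∣                              ≡⟨ sym (∣m+o-n+o∣≡∣m-n∣ m n o) ⟩
    ∣ m + o - n + o ∣                      ≤⟨ ∣-∣-triangle (m + o) (n + p) (n + o) ⟩
    ∣ m + o - n + p ∣ + ∣ n + p - n + o ∣  ≡⟨ cong (∣ m + o - n + p ∣ +_) (trans (∣m+n-m+o∣≡∣n-o∣ n p o) (∣-∣-comm p o)) ⟩
    ∣ m + o - n + p ∣ + ∣ o - p ∣          ≡⟨ +-comm ∣ m + o - n + p ∣ ∣ o - p ∣ ⟩
    ∣ o - p ∣ + ∣ m + o - n + p ∣          ∎)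
  where open ≤-Reasoning

2*m+n≡m+[m+n] : ∀ m n → 2 * m + n ≡ m + (m + n)
2*m+n≡m+[m+n] = solve-∀

2*⊓+∣-∣≡+ : ∀ a b → 2 * (a ⊓ b) + ∣ a - b ∣ ≡ a + b
2*⊓+∣-∣≡+ a b = [ ordered , swapped ]′ (≤-total a b)
  where
  ordered : ∀ {a b} → a ≤ b → 2 * (a ⊓ b) + ∣ a - b ∣ ≡ a + b
  ordered {a} {b} a≤b = begin
    2 * (a ⊓ b) + ∣ a - b ∣  ≡⟨ cong₂ (λ c d → 2 * c + d) (m≤n⇒m⊓n≡m a≤b) (m≤n⇒∣m-n∣≡n∸m a≤b) ⟩
    2 * a + (b ∸ a)          ≡⟨ 2*m+n≡m+[m+n] a (b ∸ a) ⟩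
    a + (a + (b ∸ a))        ≡⟨ cong (a +_) (m+[n∸m]≡n a≤b) ⟩
    a + b                    ∎
    where open ≡-Reasoning
  swapped : b ≤ a → 2 * (a ⊓ b) + ∣ a - b ∣ ≡ a + b
  swapped b≤a = begin
    2 * (a ⊓ b) + ∣ a - b ∣  ≡⟨ cong₂ (λ c d → 2 * c + d) (⊓-comm a b) (∣-∣-comm a b) ⟩
    2 * (b ⊓ a) + ∣ b - a ∣  ≡⟨ ordered b≤a ⟩
    b + a                    ≡⟨ +-comm b a ⟩
    a + b                    ∎
    where open ≡-Reasoning

⊓-split : ∀ w k → k ⊓ w + (k ∸ w) ⊓ w ≡ k ⊓ (2 * w)
⊓-split w k with ≤-total k w
... | inj₁ k≤w
  rewrite m≤n⇒m⊓n≡m k≤w | m≤n⇒m∸n≡0 k≤w | m≤n⇒m⊓n≡m (≤-trans k≤w (m≤m+n w (w + 0))) = +-identityʳ k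
... | inj₂ w≤k = begin
  k ⊓ w + (k ∸ w) ⊓ w        ≡⟨ cong (_+ (k ∸ w) ⊓ w) (m≥n⇒m⊓n≡n w≤k) ⟩
  w + (k ∸ w) ⊓ w            ≡⟨ +-distribˡ-⊓ w (k ∸ w) w ⟩
  (w + (k ∸ w)) ⊓ (w + w)    ≡⟨ cong₂ _⊓_ (m+[n∸m]≡n w≤k) (cong (w +_) (sym (+-identityʳ w))) ⟩
  k ⊓ (2 * w)                ∎
  where open ≡-Reasoning

2*[s∸w]+s⊓[2w∸s]≡s : ∀ w s → s ≤ 2 * w → 2 * (s ∸ w) + s ⊓ (2 * w ∸ s) ≡ s
2*[s∸w]+s⊓[2w∸s]≡s w s s≤2w with ≤-total s w
... | inj₁ s≤w rewrite m≤n⇒m∸n≡0 s≤w =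
  m≤n⇒m⊓n≡m (m+n≤o⇒m≤o∸n s (subst (s + s ≤_) (cong (w +_) (sym (+-identityʳ w))) (+-mono-≤ s≤w s≤w)))
... | inj₂ w≤s = begin
  2 * r + s ⊓ (2 * w ∸ s)  ≡⟨ cong (λ t → 2 * r + s ⊓ t) 2w∸s≡w∸r ⟩
  2 * r + s ⊓ (w ∸ r)      ≡⟨ cong (2 * r +_) (m≥n⇒m⊓n≡n (≤-trans (m∸n≤m w r) w≤s)) ⟩
  2 * r + (w ∸ r)          ≡⟨ 2*m+n≡m+[m+n] r (w ∸ r) ⟩
  r + (r + (w ∸ r))        ≡⟨ cong (r +_) (m+[n∸m]≡n r≤w) ⟩
  r + w                    ≡⟨ +-comm r w ⟩
  w + r                    ≡⟨ m+[n∸m]≡n w≤s ⟩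
  s                        ∎
  where
  open ≡-Reasoning
  r : ℕ
  r = s ∸ w
  r≤w : r ≤ w
  r≤w = subst (r ≤_) (+-identityʳ w) (m≤n+o⇒m∸n≤o s w s≤2w)
  2w∸s≡w∸r : 2 * w ∸ s ≡ w ∸ r
  2w∸s≡w∸r = begin
    2 * w ∸ s              ≡⟨ cong (2 * w ∸_) (sym (m+[n∸m]≡n w≤s)) ⟩
    w + (w + 0) ∸ (w + r)  ≡⟨ [m+n]∸[m+o]≡n∸o w (w + 0) r ⟩
    w + 0 ∸ r              ≡⟨ cong (_∸ r) (+-identityʳ w) ⟩
    w ∸ r                  ∎

^-monoʳ-∣ : ∀ b {n o} → n ≤ o → b ^ n ∣ b ^ o
^-monoʳ-∣ b {n} {o} n≤o = subst (λ e → b ^ n ∣ b ^ e) (m+[n∸m]≡n n≤o)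
  (subst (b ^ n ∣_) (sym (^-distribˡ-+-* b n (o ∸ n))) (m∣m*n (b ^ (o ∸ n))))

apart-after-doubling : ∀ x y x₀ y₀ → 2 ≤ ∣ x₀ - y₀ ∣ →
  ∣ x - 2 * x₀ ∣ + ∣ y - 2 * y₀ ∣ ≤ 2 → 2 ≤ ∣ x - y ∣
apart-after-doubling x y x₀ y₀ apart₀ err≤2 = +-cancelʳ-≤ 2 2 ∣ x - y ∣ (begin
  2 + 2                                           ≤⟨ *-monoʳ-≤ 2 apart₀ ⟩
  2 * ∣ x₀ - y₀ ∣                                 ≡⟨ *-distribˡ-∣-∣ 2 x₀ y₀ ⟩
  ∣ 2 * x₀ - 2 * y₀ ∣                             ≤⟨ ∣-∣-triangle (2 * x₀) x (2 * y₀) ⟩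
  ∣ 2 * x₀ - x ∣ + ∣ x - 2 * y₀ ∣                 ≤⟨ +-monoʳ-≤ ∣ 2 * x₀ - x ∣ (∣-∣-triangle x y (2 * y₀)) ⟩
  ∣ 2 * x₀ - x ∣ + (∣ x - y ∣ + ∣ y - 2 * y₀ ∣)   ≡⟨ cong (_+ _) (∣-∣-comm (2 * x₀) x) ⟩
  ∣ x - 2 * x₀ ∣ + (∣ x - y ∣ + ∣ y - 2 * y₀ ∣)   ≡⟨ swap-front ∣ x - 2 * x₀ ∣ ∣ x - y ∣ ∣ y - 2 * y₀ ∣ ⟩
  ∣ x - y ∣ + (∣ x - 2 * x₀ ∣ + ∣ y - 2 * y₀ ∣)   ≤⟨ +-monoʳ-≤ ∣ x - y ∣ err≤2 ⟩
  ∣ x - y ∣ + 2                                   ∎)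
  where
  open ≤-Reasoning
  swap-front : ∀ p q r → p + (q + r) ≡ q + (p + r)
  swap-front = solve-∀

-- Distance to the nearest multiple

distToMultiple : (w : ℕ) .{{_ : NonZero w}} (k : ℕ) → ℕ
distToMultiple w k = k % w ⊓ (w ∸ k % w)

module _ (w : ℕ) .{{_ : NonZero w}} where

  private
    k≡q*w+r : ∀ k → k ≡ k / w * w + k % w
    k≡q*w+r k = trans (m≡m%n+[m/n]*n k w) (+-comm (k % w) _)

  distToMultiple-attained : ∀ k → ∃[ c ] distToMultiple w k ≡ ∣ k - c * w ∣
  distToMultiple-attained k with ⊓-sel (k % w) (w ∸ k % w)
  ... | inj₁ d≡r = k / w , (begin
    distToMultiple w k                  ≡⟨ d≡r ⟩
    k % w                               ≡⟨ sym (∣m-m+n∣≡n (k / w * w) (k % w)) ⟩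
    ∣ k / w * w - k / w * w + k % w ∣   ≡⟨ ∣-∣-comm (k / w * w) (k / w * w + k % w) ⟩
    ∣ k / w * w + k % w - k / w * w ∣   ≡⟨ cong ∣_- k / w * w ∣ (sym (k≡q*w+r k)) ⟩
    ∣ k - k / w * w ∣                   ∎)
    where open ≡-Reasoning
  ... | inj₂ d≡w∸r = suc (k / w) , (begin
    distToMultiple w k                        ≡⟨ d≡w∸r ⟩
    w ∸ k % w                                 ≡⟨ sym (m≤n⇒∣m-n∣≡n∸m (m%n≤n k w)) ⟩
    ∣ k % w - w ∣                             ≡⟨ sym (∣m+n-m+o∣≡∣n-o∣ (k / w * w) _ _) ⟩
    ∣ k / w * w + k % w - k / w * w + w ∣     ≡⟨ cong₂ ∣_-_∣ (sym (k≡q*w+r k)) (+-comm _ w) ⟩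
    ∣ k - suc (k / w) * w ∣                   ∎)
    where open ≡-Reasoning

  distToMultiple-minimal : ∀ k c → distToMultiple w k ≤ ∣ k - c * w ∣
  distToMultiple-minimal k c with c ≤? k / w
  ... | yes c≤q = begin
    distToMultiple w k                   ≤⟨ m⊓n≤m _ _ ⟩
    k % w                                ≡⟨ sym (m+n∸m≡n (k / w * w) _) ⟩
    k / w * w + k % w ∸ k / w * w        ≡⟨ cong (_∸ k / w * w) (sym (k≡q*w+r k)) ⟩
    k ∸ k / w * w                        ≤⟨ ∸-monoʳ-≤ k (*-monoˡ-≤ w c≤q) ⟩
    k ∸ c * w                            ≤⟨ m∸n≤∣m-n∣ k (c * w) ⟩
    ∣ k - c * w ∣                        ∎
    where open ≤-Reasoning
  ... | no c≰q = begin
    distToMultiple w k                   ≤⟨ m⊓n≤n _ _ ⟩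
    w ∸ k % w                            ≡⟨ sym ([m+n]∸[m+o]≡n∸o (k / w * w) w (k % w)) ⟩
    k / w * w + w ∸ (k / w * w + k % w)  ≡⟨ cong₂ _∸_ (+-comm _ w) (sym (k≡q*w+r k)) ⟩
    suc (k / w) * w ∸ k                  ≤⟨ ∸-monoˡ-≤ k (*-monoˡ-≤ w (≰⇒> c≰q)) ⟩
    c * w ∸ k                            ≤⟨ m∸n≤∣m-n∣ (c * w) k ⟩
    ∣ c * w - k ∣                        ≡⟨ ∣-∣-comm (c * w) k ⟩
    ∣ k - c * w ∣                        ∎
    where open ≤-Reasoning

  distToMultiple-lipschitz : ∀ y z → ∣ distToMultiple w y - distToMultiple w z ∣ ≤ ∣ y - z ∣
  distToMultiple-lipschitz y z = m≤o+n⇒n≤o+m⇒∣m-n∣≤o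
    (one-sided y z)
    (subst (λ d → distToMultiple w z ≤ d + distToMultiple w y) (∣-∣-comm z y) (one-sided z y))
    where
    one-sided : ∀ y z → distToMultiple w y ≤ ∣ y - z ∣ + distToMultiple w z
    one-sided y z with distToMultiple-attained z
    ... | c , d≡ = begin
      distToMultiple w y              ≤⟨ distToMultiple-minimal y c ⟩
      ∣ y - c * w ∣                   ≤⟨ ∣-∣-triangle y z (c * w) ⟩
      ∣ y - z ∣ + ∣ z - c * w ∣       ≡⟨ cong (∣ y - z ∣ +_) (sym d≡) ⟩
      ∣ y - z ∣ + distToMultiple w z  ∎
      where open ≤-Reasoning

  ∣⇒distToMultiple≡0 : ∀ {k} → w ∣ k → distToMultiple w k ≡ 0
  ∣⇒distToMultiple≡0 {k} w∣k = cong (_⊓ (w ∸ k % w)) (n∣m⇒m%n≡0 k w w∣k)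

  distToMultiple≡0⇒∣ : ∀ {k} → distToMultiple w k ≡ 0 → w ∣ k
  distToMultiple≡0⇒∣ {k} d≡0 with ⊓-sel (k % w) (w ∸ k % w)
  ... | inj₁ d≡r   = m%n≡0⇒n∣m k w (trans (sym d≡r) d≡0)
  ... | inj₂ d≡w∸r = contradiction (m∸n≡0⇒m≤n (trans (sym d≡w∸r) d≡0)) (<⇒≱ (m%n<n k w))

  distToMultiple-+ˡ : ∀ {v} k → w ∣ v → distToMultiple w (v + k) ≡ distToMultiple w k
  distToMultiple-+ˡ {v} k w∣v = cong (λ r → r ⊓ (w ∸ r)) (%-remove-+ˡ k w∣v)

  distToMultiple-≤w : ∀ {k} → k ≤ w → distToMultiple w k ≡ k ⊓ (w ∸ k)
  distToMultiple-≤w {k} k≤w with m≤n⇒m<n∨m≡n k≤w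
  ... | inj₁ k<w = cong (λ r → r ⊓ (w ∸ r)) (m<n⇒m%n≡m k<w)
  ... | inj₂ refl = begin
    w % w ⊓ (w ∸ w % w)   ≡⟨ cong (λ r → r ⊓ (w ∸ r)) (n%n≡0 w) ⟩
    0                     ≡⟨ sym (⊓-zeroʳ w) ⟩
    w ⊓ 0                 ≡⟨ cong (w ⊓_) (sym (n∸n≡0 w)) ⟩
    w ⊓ (w ∸ w)           ∎
    where open ≡-Reasoning

  distToMultiple-⊓-split : ∀ {u} k → w ∣ u →
    distToMultiple w (k ⊓ (2 * u)) ≡ distToMultiple w (k ⊓ u) + distToMultiple w ((k ∸ u) ⊓ u)
  distToMultiple-⊓-split {u} k w∣u with ≤-total k u
  ... | inj₁ k≤u
    rewrite m≤n⇒m⊓n≡m k≤u | m≤n⇒m∸n≡0 k≤u | m≤n⇒m⊓n≡m (≤-trans k≤u (m≤m+n u (u + 0)))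
          | ∣⇒distToMultiple≡0 (w ∣0) = sym (+-identityʳ _)
  ... | inj₂ u≤k = begin
    distToMultiple w (k ⊓ (2 * u))
      ≡⟨ cong (distToMultiple w) (sym (⊓-split u k)) ⟩
    distToMultiple w (k ⊓ u + r)
      ≡⟨ cong (λ x → distToMultiple w (x + r)) (m≥n⇒m⊓n≡n u≤k) ⟩
    distToMultiple w (u + r)
      ≡⟨ distToMultiple-+ˡ r w∣u ⟩
    distToMultiple w r
      ≡⟨ cong (_+ distToMultiple w r) (sym (∣⇒distToMultiple≡0 w∣u)) ⟩
    distToMultiple w u + distToMultiple w r
      ≡⟨ cong (λ x → distToMultiple w x + distToMultiple w r) (sym (m≥n⇒m⊓n≡n u≤k)) ⟩
    distToMultiple w (k ⊓ u) + distToMultiple w r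
      ∎
    where
    open ≡-Reasoning
    r : ℕ
    r = (k ∸ u) ⊓ u

distToMultiple-*ˡ : ∀ c w .{{_ : NonZero c}} .{{_ : NonZero w}} k →
  distToMultiple (c * w) {{m*n≢0 c w}} (c * k) ≡ c * distToMultiple w k
distToMultiple-*ˡ c w k = begin
  (c * k) % (c * w) ⊓ (c * w ∸ (c * k) % (c * w))  ≡⟨ cong (λ r → r ⊓ (c * w ∸ r)) %-*ˡ ⟩
  c * (k % w) ⊓ (c * w ∸ c * (k % w))              ≡⟨ cong (c * (k % w) ⊓_) (sym (*-distribˡ-∸ c w (k % w))) ⟩
  c * (k % w) ⊓ (c * (w ∸ k % w))                  ≡⟨ sym (*-distribˡ-⊓ c (k % w) (w ∸ k % w)) ⟩
  c * distToMultiple w k                           ∎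
  where
  open ≡-Reasoning
  instance
    c*w≢0 : NonZero (c * w)
    c*w≢0 = m*n≢0 c w
    w*c≢0 : NonZero (w * c)
    w*c≢0 = m*n≢0 w c
  %-*ˡ : (c * k) % (c * w) ≡ c * (k % w)
  %-*ˡ = begin
    (c * k) % (c * w)  ≡⟨ cong (_% (c * w)) (*-comm c k) ⟩
    (k * c) % (c * w)  ≡⟨ %-congʳ (*-comm c w) ⟩
    (k * c) % (w * c)  ≡⟨ sym (m%n*o≡m*o%[n*o] k w c) ⟩
    k % w * c          ≡⟨ *-comm (k % w) c ⟩
    c * (k % w)        ∎

dist2^ : ℕ → ℕ → ℕ
dist2^ l = distToMultiple (2 ^ l) {{m^n≢0 2 l}}

dist2^-∣ : ∀ l k → 2 ^ l ∣ k → dist2^ l k ≡ 0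
dist2^-∣ l k = ∣⇒distToMultiple≡0 (2 ^ l) {{m^n≢0 2 l}}

dist2^-zero : ∀ k → dist2^ 0 k ≡ 0
dist2^-zero k = dist2^-∣ 0 k (1∣ k)

dist2^-double : ∀ l k → dist2^ (suc l) (2 * k) ≡ 2 * dist2^ l k
dist2^-double l = distToMultiple-*ˡ 2 (2 ^ l) {{_}} {{m^n≢0 2 l}}

dist2^-halve : ∀ l k k₀ → ∣ dist2^ l k - 2 * dist2^ (l ∸ 1) k₀ ∣ ≤ ∣ k - 2 * k₀ ∣
dist2^-halve zero k k₀ rewrite dist2^-zero k | dist2^-zero k₀ = z≤n
dist2^-halve (suc l) k k₀ rewrite sym (dist2^-double l k₀) =
  distToMultiple-lipschitz (2 ^ suc l) {{m^n≢0 2 (suc l)}} k (2 * k₀)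

dist2^-odd>0 : ∀ l q → 0 < dist2^ (suc l) (suc (2 * q))
dist2^-odd>0 l q = n≢0⇒n>0 λ d≡0 → 2≢1 (∣1⇒≡1 (2∣odd⇒2∣1 (∣-trans (m∣m*n (2 ^ l))
  (distToMultiple≡0⇒∣ (2 ^ suc l) {{m^n≢0 2 (suc l)}} d≡0))))
  where
  2≢1 : 2 ≢ 1
  2≢1 ()
  2∣odd⇒2∣1 : 2 ∣ suc (2 * q) → 2 ∣ 1
  2∣odd⇒2∣1 2∣odd = ∣m+n∣m⇒∣n (subst (2 ∣_) (+-comm 1 (2 * q)) 2∣odd) (m∣m*n q)

dist2^-quadruple : ∀ l k → dist2^ (2 + l) (4 * k) ≡ 4 * dist2^ l k
dist2^-quadruple l k = begin
  dist2^ (2 + l) (4 * k)        ≡⟨ cong (dist2^ (2 + l)) (*-assoc 2 2 k) ⟩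
  dist2^ (2 + l) (2 * (2 * k))  ≡⟨ dist2^-double (suc l) (2 * k) ⟩
  2 * dist2^ (1 + l) (2 * k)    ≡⟨ cong (2 *_) (dist2^-double l k) ⟩
  2 * (2 * dist2^ l k)          ≡⟨ sym (*-assoc 2 2 (dist2^ l k)) ⟩
  4 * dist2^ l k                ∎
  where open ≡-Reasoning

dist2^-4*odd : ∀ l q → dist2^ l (4 * suc (2 * q)) ≡ 0 ⊎ 4 ≤ dist2^ l (4 * suc (2 * q))
dist2^-4*odd 0 q = inj₁ (dist2^-∣ 0 (4 * suc (2 * q)) (1∣ _))
dist2^-4*odd 1 q = inj₁ (dist2^-∣ 1 (4 * suc (2 * q)) (∣-trans (divides 2 refl) (m∣m*n (suc (2 * q)))))
dist2^-4*odd 2 q = inj₁ (dist2^-∣ 2 (4 * suc (2 * q)) (m∣m*n (suc (2 * q))))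
dist2^-4*odd (suc (suc (suc l))) q =
  inj₂ (subst (4 ≤_) (sym (dist2^-quadruple (suc l) _)) (*-monoʳ-≤ 4 (dist2^-odd>0 l q)))

-- Column counts of initial segments

filter-map : ∀ {a b p} {X : Set a} {Y : Set b} {P : Pred Y p} (P? : Decidable P) (f : X → Y) xs →
  filter P? (map f xs) ≡ map f (filter (P? ∘ f) xs)
filter-map P? f [] = refl
filter-map P? f (x ∷ xs) with does (P? (f x))
... | true  = cong (f x ∷_) (filter-map P? f xs)
... | false = filter-map P? f xs

I-suc : ∀ N k → I (suc N) k ≡ map (false ∷_) (I N k) ++ map (true ∷_) (I N (k ∸ 2 ^ N))
I-suc N k = begin
  filter (value<? k) (map (false ∷_) (Q N) ++ map (true ∷_) (Q N))
    ≡⟨ filter-++ (value<? k) (map (false ∷_) (Q N)) _ ⟩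
  filter (value<? k) (map (false ∷_) (Q N)) ++ filter (value<? k) (map (true ∷_) (Q N))
    ≡⟨ cong₂ _++_ (filter-map (value<? k) (false ∷_) (Q N)) (filter-map (value<? k) (true ∷_) (Q N)) ⟩
  map (false ∷_) (I N k) ++ map (true ∷_) (filter (value<? k ∘ (true ∷_)) (Q N))
    ≡⟨ cong (λ xs → map (false ∷_) (I N k) ++ map (true ∷_) xs)
            (filter-≐ (value<? k ∘ (true ∷_)) (value<? (k ∸ 2 ^ N)) (drop-top , add-top) (Q N)) ⟩
  map (false ∷_) (I N k) ++ map (true ∷_) (I N (k ∸ 2 ^ N))
    ∎
  where
  open ≡-Reasoning
  value<? : ∀ {M} k (x : Vec Bool M) → Dec (value x < k)
  value<? k x = value x <? k
  -- value (true ∷ x) normalises to 2 ^ N + 0 + value x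
  drop-top : ∀ {x : Vec Bool N} → value (true ∷ x) < k → value x < k ∸ 2 ^ N
  drop-top {x} lt = m+n≤o⇒m≤o∸n (suc (value x))
    (subst (_≤ k) (cong suc (trans (cong (_+ value x) (+-identityʳ (2 ^ N))) (+-comm (2 ^ N) (value x)))) lt)
  add-top : ∀ {x : Vec Bool N} → value x < k ∸ 2 ^ N → value (true ∷ x) < k
  add-top {x} lt = subst (_≤ k)
    (cong suc (trans (+-comm (value x) (2 ^ N)) (cong (_+ value x) (sym (+-identityʳ (2 ^ N))))))
    (m≤o∸n⇒m+n≤o (suc (value x)) (<⇒≤ (m∸n≢0⇒n<m (m<n⇒n≢0 lt))) lt)

m-++ : ∀ {N} (j : Fin N) xs ys → m j (xs ++ ys) ≡ m j xs + m j ys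
m-++ j xs ys = trans (cong length (filter-++ _ xs ys)) (length-++ (filter _ xs))

m-zero-false∷ : ∀ {N} (xs : List (Vec Bool N)) → m zero (map (false ∷_) xs) ≡ 0
m-zero-false∷ []       = refl
m-zero-false∷ (x ∷ xs) = m-zero-false∷ xs

m-zero-true∷ : ∀ {N} (xs : List (Vec Bool N)) → m zero (map (true ∷_) xs) ≡ length xs
m-zero-true∷ []       = refl
m-zero-true∷ (x ∷ xs) = cong suc (m-zero-true∷ xs)

m-suc-∷ : ∀ {N} b (j : Fin N) xs → m (suc j) (map (b ∷_) xs) ≡ m j xs
m-suc-∷ b j xs =
  trans (cong length (filter-map _ (b ∷_) xs)) (length-map {B = Vec Bool (suc _)} (b ∷_) (filter _ xs))

m-zero-I-suc : ∀ N k → m zero (I (suc N) k) ≡ length (I N (k ∸ 2 ^ N))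
m-zero-I-suc N k = begin
  m zero (I (suc N) k)                  ≡⟨ cong (m zero) (I-suc N k) ⟩
  m zero (map (false ∷_) (I N k) ++ map (true ∷_) (I N (k ∸ 2 ^ N)))
    ≡⟨ m-++ zero (map (false ∷_) (I N k)) _ ⟩
  m zero (map (false ∷_) (I N k)) + m zero (map (true ∷_) (I N (k ∸ 2 ^ N)))
    ≡⟨ cong₂ _+_ (m-zero-false∷ (I N k)) (m-zero-true∷ (I N (k ∸ 2 ^ N))) ⟩
  length (I N (k ∸ 2 ^ N))              ∎
  where open ≡-Reasoning

m-suc-I-suc : ∀ N (j : Fin N) k → m (suc j) (I (suc N) k) ≡ m j (I N k) + m j (I N (k ∸ 2 ^ N))
m-suc-I-suc N j k = begin
  m (suc j) (I (suc N) k)                ≡⟨ cong (m (suc j)) (I-suc N k) ⟩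
  m (suc j) (map (false ∷_) (I N k) ++ map (true ∷_) (I N (k ∸ 2 ^ N)))
    ≡⟨ m-++ (suc j) (map (false ∷_) (I N k)) _ ⟩
  m (suc j) (map (false ∷_) (I N k)) + m (suc j) (map (true ∷_) (I N (k ∸ 2 ^ N)))
    ≡⟨ cong₂ _+_ (m-suc-∷ false j (I N k)) (m-suc-∷ true j (I N (k ∸ 2 ^ N))) ⟩
  m j (I N k) + m j (I N (k ∸ 2 ^ N))    ∎
  where open ≡-Reasoning

length-I : ∀ N k → length (I N k) ≡ k ⊓ 2 ^ N
length-I zero    zero    = refl
length-I zero    (suc k) = cong suc (sym (⊓-zeroʳ k))
length-I (suc N) k = begin
  length (I (suc N) k)                   ≡⟨ cong length (I-suc N k) ⟩
  length (map (false ∷_) (I N k) ++ map (true ∷_) (I N (k ∸ 2 ^ N)))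
    ≡⟨ length-++ (map (false ∷_) (I N k)) ⟩
  length (map (false ∷_) (I N k)) + length (map (true ∷_) (I N (k ∸ 2 ^ N)))
    ≡⟨ cong₂ _+_ (length-map _ (I N k)) (length-map _ (I N (k ∸ 2 ^ N))) ⟩
  length (I N k) + length (I N (k ∸ 2 ^ N))
    ≡⟨ cong₂ _+_ (length-I N k) (length-I N (k ∸ 2 ^ N)) ⟩
  k ⊓ 2 ^ N + (k ∸ 2 ^ N) ⊓ 2 ^ N        ≡⟨ ⊓-split (2 ^ N) k ⟩
  k ⊓ 2 ^ suc N                          ∎
  where open ≡-Reasoning

column-count : ∀ N (j : Fin N) k →
  2 * m j (I N k) + dist2^ (N ∸ toℕ j) (k ⊓ 2 ^ N) ≡ k ⊓ 2 ^ N
column-count (suc N) zero k = begin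
  2 * m zero (I (suc N) k) + dist2^ (suc N) s
    ≡⟨ cong₂ (λ c d → 2 * c + d) m≡s∸w (distToMultiple-≤w (2 ^ suc N) {{m^n≢0 2 (suc N)}} s≤2w) ⟩
  2 * (s ∸ w) + s ⊓ (2 * w ∸ s)
    ≡⟨ 2*[s∸w]+s⊓[2w∸s]≡s w s s≤2w ⟩
  s
    ∎
  where
  open ≡-Reasoning
  w s : ℕ
  w = 2 ^ N
  s = k ⊓ (2 * w)
  s≤2w : s ≤ 2 * w
  s≤2w = m⊓n≤n k (2 * w)
  m≡s∸w : m zero (I (suc N) k) ≡ s ∸ w
  m≡s∸w = begin
    m zero (I (suc N) k)     ≡⟨ m-zero-I-suc N k ⟩
    length (I N (k ∸ w))     ≡⟨ length-I N (k ∸ w) ⟩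
    (k ∸ w) ⊓ w              ≡⟨ cong ((k ∸ w) ⊓_) (sym (trans (m+n∸m≡n w (w + 0)) (+-identityʳ w))) ⟩
    (k ∸ w) ⊓ (2 * w ∸ w)    ≡⟨ sym (∸-distribʳ-⊓ w k (2 * w)) ⟩
    s ∸ w                    ∎
column-count (suc N) (suc j) k = begin
  2 * m (suc j) (I (suc N) k) + dist2^ l (k ⊓ (2 * w))
    ≡⟨ cong₂ (λ c d → 2 * c + d) (m-suc-I-suc N j k)
             (distToMultiple-⊓-split (2 ^ l) {{m^n≢0 2 l}} k (^-monoʳ-∣ 2 (m∸n≤m N (toℕ j)))) ⟩
  2 * (m j (I N k) + m j (I N (k ∸ w))) + (dist2^ l (k ⊓ w) + dist2^ l ((k ∸ w) ⊓ w))
    ≡⟨ interchange (m j (I N k)) (m j (I N (k ∸ w))) _ _ ⟩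
  (2 * m j (I N k) + dist2^ l (k ⊓ w)) + (2 * m j (I N (k ∸ w)) + dist2^ l ((k ∸ w) ⊓ w))
    ≡⟨ cong₂ _+_ (column-count N j k) (column-count N j (k ∸ w)) ⟩
  k ⊓ w + (k ∸ w) ⊓ w
    ≡⟨ ⊓-split w k ⟩
  k ⊓ (2 * w)
    ∎
  where
  open ≡-Reasoning
  w l : ℕ
  w = 2 ^ N
  l = N ∸ toℕ j
  interchange : ∀ a b c d → 2 * (a + b) + (c + d) ≡ (2 * a + c) + (2 * b + d)
  interchange = solve-∀

m≡⊓⇒dist2^≡∣-∣ : ∀ N (j : Fin N) a b → a + b ≤ 2 ^ N →
  m j (I N (a + b)) ≡ a ⊓ b → dist2^ (N ∸ toℕ j) (a + b) ≡ ∣ a - b ∣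
m≡⊓⇒dist2^≡∣-∣ N j a b a+b≤2^N fit = +-cancelˡ-≡ (2 * (a ⊓ b)) _ _ (begin
  2 * (a ⊓ b) + dist2^ l (a + b)            ≡⟨ cong (λ c → 2 * c + dist2^ l (a + b)) (sym fit) ⟩
  2 * m j (I N (a + b)) + dist2^ l (a + b)  ≡⟨ subst (λ s → 2 * m j (I N (a + b)) + dist2^ l s ≡ s)
                                                     (m≤n⇒m⊓n≡m a+b≤2^N) (column-count N j (a + b)) ⟩
  a + b                                     ≡⟨ sym (2*⊓+∣-∣≡+ a b) ⟩
  2 * (a ⊓ b) + ∣ a - b ∣                   ∎)
  where
  open ≡-Reasoning
  l : ℕ
  l = N ∸ toℕ j

-- Robust unfitness of the pairs in A

record RobustlyUnfit (a b : ℕ) : Set where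
  constructor robustlyUnfit
  field apart : ∀ l → 2 ≤ ∣ ∣ a - b ∣ - dist2^ l (a + b) ∣

RobustlyUnfit-swap : ∀ {a b} → RobustlyUnfit a b → RobustlyUnfit b a
RobustlyUnfit-swap {a} {b} (robustlyUnfit apart) = robustlyUnfit λ l →
  subst₂ (λ d k → 2 ≤ ∣ d - dist2^ l k ∣) (∣-∣-comm a b) (+-comm a b) (apart l)

RobustlyUnfit-3+q*4 : ∀ q → RobustlyUnfit (3 + q * 4) (1 + q * 4)
RobustlyUnfit-3+q*4 q = robustlyUnfit λ l →
  subst₂ (λ d k → 2 ≤ ∣ d - dist2^ l k ∣) (sym ∣a-b∣≡2) (sym a+b≡4*odd) (apart (dist2^-4*odd l q))
  where
  ∣a-b∣≡2 : ∣ 3 + q * 4 - 1 + q * 4 ∣ ≡ 2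
  ∣a-b∣≡2 = begin
    ∣ 2 + q * 4 - q * 4 ∣  ≡⟨ ∣-∣-comm (2 + q * 4) (q * 4) ⟩
    ∣ q * 4 - 2 + q * 4 ∣  ≡⟨ cong ∣ q * 4 -_∣ (+-comm 2 (q * 4)) ⟩
    ∣ q * 4 - q * 4 + 2 ∣  ≡⟨ ∣m-m+n∣≡n (q * 4) 2 ⟩
    2                      ∎
    where open ≡-Reasoning
  a+b≡4*odd : 3 + q * 4 + (1 + q * 4) ≡ 4 * suc (2 * q)
  a+b≡4*odd = ring q
    where
    ring : ∀ x → 3 + x * 4 + (1 + x * 4) ≡ 4 * suc (2 * x)
    ring = solve-∀
  apart : ∀ {d} → d ≡ 0 ⊎ 4 ≤ d → 2 ≤ ∣ 2 - d ∣
  apart (inj₁ refl) = ≤-refl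
  apart (inj₂ 4≤d)  = subst (2 ≤_) (sym (m≤n⇒∣m-n∣≡n∸m (m+n≤o⇒n≤o 2 4≤d))) (∸-monoˡ-≤ 2 4≤d)

RobustlyUnfit-%4≡3 : ∀ {a} → a % 4 ≡ 3 → RobustlyUnfit a (a ∸ 2)
RobustlyUnfit-%4≡3 {a} a%4≡3 = subst (λ x → RobustlyUnfit x (x ∸ 2)) (sym a≡3+q*4) (RobustlyUnfit-3+q*4 (a / 4))
  where
  a≡3+q*4 : a ≡ 3 + a / 4 * 4
  a≡3+q*4 = trans (m≡m%n+[m/n]*n a 4) (cong (_+ a / 4 * 4) a%4≡3)

rounding≤2 : ∀ (da db : Fin 3) → ∣ toℕ da - toℕ db ∣ + ∣ toℕ da + toℕ db - 2 ∣ ≤ 2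
rounding≤2 zero             zero             = ≤-refl
rounding≤2 zero             (suc zero)       = ≤-refl
rounding≤2 zero             (suc (suc zero)) = ≤-refl
rounding≤2 (suc zero)       zero             = ≤-refl
rounding≤2 (suc zero)       (suc zero)       = z≤n
rounding≤2 (suc zero)       (suc (suc zero)) = ≤-refl
rounding≤2 (suc (suc zero)) zero             = ≤-refl
rounding≤2 (suc (suc zero)) (suc zero)       = ≤-refl
rounding≤2 (suc (suc zero)) (suc (suc zero)) = ≤-refl

RobustlyUnfit-lift : ∀ {a₀ b₀ a b} (da db : Fin 3) →
  a + 1 ≡ 2 * a₀ + toℕ da → b + 1 ≡ 2 * b₀ + toℕ db →
  RobustlyUnfit a₀ b₀ → RobustlyUnfit a b
RobustlyUnfit-lift {a₀} {b₀} {a} {b} da db ea eb (robustlyUnfit apart₀) = robustlyUnfit λ l →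
  apart-after-doubling ∣ a - b ∣ (dist2^ l (a + b)) ∣ a₀ - b₀ ∣ (dist2^ (l ∸ 1) (a₀ + b₀))
    (apart₀ (l ∸ 1)) (≤-trans (+-mono-≤ diff-error (dist-error l)) (rounding≤2 da db))
  where
  open ≤-Reasoning
  diff-error : ∣ ∣ a - b ∣ - 2 * ∣ a₀ - b₀ ∣ ∣ ≤ ∣ toℕ da - toℕ db ∣
  diff-error = begin
    ∣ ∣ a - b ∣ - 2 * ∣ a₀ - b₀ ∣ ∣
      ≡⟨ cong₂ (λ d d₀ → ∣ d - d₀ ∣) (sym (∣m+o-n+o∣≡∣m-n∣ a b 1)) (*-distribˡ-∣-∣ 2 a₀ b₀) ⟩
    ∣ ∣ a + 1 - b + 1 ∣ - ∣ 2 * a₀ - 2 * b₀ ∣ ∣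
      ≡⟨ cong₂ (λ x y → ∣ ∣ x - y ∣ - ∣ 2 * a₀ - 2 * b₀ ∣ ∣) ea eb ⟩
    ∣ ∣ 2 * a₀ + toℕ da - 2 * b₀ + toℕ db ∣ - ∣ 2 * a₀ - 2 * b₀ ∣ ∣
      ≤⟨ ∣∣m+o-n+p∣-∣m-n∣∣≤∣o-p∣ (2 * a₀) (2 * b₀) (toℕ da) (toℕ db) ⟩
    ∣ toℕ da - toℕ db ∣
      ∎
  a+b+2≡ : a + b + 2 ≡ 2 * (a₀ + b₀) + (toℕ da + toℕ db)
  a+b+2≡ = begin-equality
    a + b + 2                               ≡⟨ regroup a b ⟩
    (a + 1) + (b + 1)                       ≡⟨ cong₂ _+_ ea eb ⟩
    (2 * a₀ + toℕ da) + (2 * b₀ + toℕ db)   ≡⟨ interchange a₀ b₀ (toℕ da) (toℕ db) ⟩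
    2 * (a₀ + b₀) + (toℕ da + toℕ db)       ∎
    where
    regroup : ∀ x y → x + y + 2 ≡ (x + 1) + (y + 1)
    regroup = solve-∀
    interchange : ∀ x y u v → (2 * x + u) + (2 * y + v) ≡ 2 * (x + y) + (u + v)
    interchange = solve-∀
  dist-error : ∀ l → ∣ dist2^ l (a + b) - 2 * dist2^ (l ∸ 1) (a₀ + b₀) ∣ ≤ ∣ toℕ da + toℕ db - 2 ∣
  dist-error l = begin
    ∣ dist2^ l (a + b) - 2 * dist2^ (l ∸ 1) (a₀ + b₀) ∣         ≤⟨ dist2^-halve l (a + b) (a₀ + b₀) ⟩
    ∣ a + b - 2 * (a₀ + b₀) ∣                                   ≡⟨ sym (∣m+o-n+o∣≡∣m-n∣ (a + b) _ 2) ⟩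
    ∣ a + b + 2 - 2 * (a₀ + b₀) + 2 ∣                           ≡⟨ cong ∣_- 2 * (a₀ + b₀) + 2 ∣ a+b+2≡ ⟩
    ∣ 2 * (a₀ + b₀) + (toℕ da + toℕ db) - 2 * (a₀ + b₀) + 2 ∣   ≡⟨ ∣m+n-m+o∣≡∣n-o∣ (2 * (a₀ + b₀)) _ 2 ⟩
    ∣ toℕ da + toℕ db - 2 ∣                                     ∎

A⇒RobustlyUnfit : ∀ {n a b} → A n (a , b) → RobustlyUnfit a b
A⇒RobustlyUnfit base₁                 = RobustlyUnfit-swap (RobustlyUnfit-3+q*4 3)
A⇒RobustlyUnfit base₂                 = RobustlyUnfit-3+q*4 3
A⇒RobustlyUnfit (lift p da db ea eb)  = RobustlyUnfit-lift da db ea eb (A⇒RobustlyUnfit p)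
A⇒RobustlyUnfit (new₁ _ a%4≡3 _)      = RobustlyUnfit-%4≡3 a%4≡3
A⇒RobustlyUnfit (new₂ _ a%4≡3 _)      = RobustlyUnfit-swap (RobustlyUnfit-%4≡3 a%4≡3)

lift-< : ∀ {a a₀ w} (da : Fin 3) → a + 1 ≡ 2 * a₀ + toℕ da → a₀ < w → a < 2 * w
lift-< {a} {a₀} {w} da e a₀<w = begin
  suc a              ≡⟨ +-comm 1 a ⟩
  a + 1              ≡⟨ e ⟩
  2 * a₀ + toℕ da    ≤⟨ +-monoʳ-≤ (2 * a₀) (toℕ≤pred[n] da) ⟩
  2 * a₀ + 2         ≡⟨ +-comm (2 * a₀) 2 ⟩
  2 + 2 * a₀         ≡⟨ sym (*-suc 2 a₀) ⟩
  2 * suc a₀         ≤⟨ *-monoʳ-≤ 2 a₀<w ⟩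
  2 * w              ∎
  where open ≤-Reasoning

A⇒<2^n : ∀ {n a b} → A n (a , b) → a < 2 ^ n × b < 2 ^ n
A⇒<2^n base₁ = toWitness {a? = 13 <? 16} _ , toWitness {a? = 15 <? 16} _
A⇒<2^n base₂ = toWitness {a? = 15 <? 16} _ , toWitness {a? = 13 <? 16} _
A⇒<2^n (lift p da db ea eb) with A⇒<2^n p
... | a₀<2^n , b₀<2^n = lift-< da ea a₀<2^n , lift-< db eb b₀<2^n
A⇒<2^n (new₁ _ _ (_ , a<2^n , _ , b<2^n , _)) = a<2^n , b<2^n
A⇒<2^n (new₂ _ _ (_ , a<2^n , _ , b<2^n , _)) = a<2^n , b<2^n

mainTheorem10 : (n : ℕ) → 4 ≤ n → (a b : ℕ) → A n (a , b) →
    (j : Fin (suc n)) → m j (I (suc n) (a + b)) ≢ a ⊓ b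
mainTheorem10 n _ a b p j fit = contradiction (begin
  2                                          ≤⟨ RobustlyUnfit.apart (A⇒RobustlyUnfit p) l ⟩
  ∣ ∣ a - b ∣ - dist2^ l (a + b) ∣           ≡⟨ cong ∣ ∣ a - b ∣ -_∣ (m≡⊓⇒dist2^≡∣-∣ (suc n) j a b a+b≤2^[1+n] fit) ⟩
  ∣ ∣ a - b ∣ - ∣ a - b ∣ ∣                  ≡⟨ ∣n-n∣≡0 ∣ a - b ∣ ⟩
  0                                          ∎) λ ()
  where
  open ≤-Reasoning
  l : ℕ
  l = suc n ∸ toℕ j
  a+b≤2^[1+n] : a + b ≤ 2 ^ suc n
  a+b≤2^[1+n] with A⇒<2^n p
  ... | a<2^n , b<2^n = subst (a + b ≤_) (cong (2 ^ n +_) (sym (+-identityʳ (2 ^ n))))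
                              (+-mono-≤ (<⇒≤ a<2^n) (<⇒≤ b<2^n))
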